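{- Let $n\ge1$. For $\pi\in S_{n-1}$ and $a\in[n-1]$ let $\mathrm{ins}_a(\pi)\in S_n$ be obtained by inserting $n$ immediately after the entry $a$ in the one-line notation of $\pi$, and let $\mathrm{ins}_\emptyset(\pi)$ be obtained by inserting $n$ at the beginning. Then the map $\Psi:\{\emptyset,1,\dots,n-1\}\times S_{n-1}\to S_n$, $\Psi(a,\pi)=\mathrm{ins}_a(\pi)$, is a bijection, and with $\pi'=\mathrm{ins}_a(\pi)$ and (when $a$ is not the last entry of $\pi$) $k$ the entry immediately after $a$ in $\pi$: (1) if $a=\emptyset$ then $\mathrm{PKV}(\pi')=\mathrm{PKV}(\pi)$; (2) if $a$ is the last entry of $\pi$ then $\mathrm{PKV}(\pi')=\mathrm{PKV}(\pi)$; (3) if $a\in\mathrm{PKV}(\pi)$ then $\mathrm{PKV}(\pi')=(\mathrm{PKV}(\pi)\setminus\{a\})\cup\{n\}$; (4) if $k\in\mathrm{PKV}(\pi)$ then $\mathrm{PKV}(\pi')=(\mathrm{PKV}(\pi)\setminus\{k\})\cup\{n\}$; (5) if $a$ is not the last entry of $\pi$ and neither $a$ nor $k$ lies in $\mathrm{PKV}(\pi)$, then $\mathrm{PKV}(\pi')=\mathrm{PKV}(\pi)\cup\{n\}$.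
   Context: For $\pi\in S_m$ in one-line notation, an index $i$ with $1<i<m$ is a peak if $\pi(i-1)<\pi(i)>\pi(i+1)$, and then $\pi(i)$ is a peak-value; $\mathrm{PKV}(\pi)$ is the set of peak-values of $\pi$. -}

module Defs where

open import Data.Nat using (ℕ; zero; suc; _≤_; _<_; _≡ᵇ_)
open import Data.Bool using (if_then_else_)
open import Data.List using (List; []; _∷_; _++_; [_]; applyUpTo)
open import Data.Maybe using (Maybe; nothing; just)
open import Data.Product using (_×_; ∃-syntax)
open import Data.Unit using (⊤)
open import Relation.Binary.PropositionalEquality using (_≡_)
open import Data.List.Relation.Binary.Permutation.Propositional using (_↭_)

oneTo : ℕ → List ℕ
oneTo m = applyUpTo suc m

IsPerm : ℕ → List ℕ → Set
IsPerm m π = π ↭ oneTo m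

-- Insertion positions {∅,1,…,m}: nothing = ∅, just a with 1 ≤ a ≤ m.
ValidPos : ℕ → Maybe ℕ → Set
ValidPos m nothing  = ⊤
ValidPos m (just a) = 1 ≤ a × a ≤ m

ins : ℕ → Maybe ℕ → List ℕ → List ℕ
ins n nothing  π        = n ∷ π
ins n (just a) []       = []
ins n (just a) (x ∷ xs) = if x ≡ᵇ a then x ∷ n ∷ xs else x ∷ ins n (just a) xs

PKV : List ℕ → ℕ → Set
PKV π y = ∃[ ls ] ∃[ rs ] ∃[ x ] ∃[ z ]
  (π ≡ ls ++ x ∷ y ∷ z ∷ rs) × x < y × z < y

IsLast : List ℕ → ℕ → Set
IsLast π a = ∃[ ls ] π ≡ ls ++ [ a ]

Next : List ℕ → ℕ → ℕ → Set
Next π a k = ∃[ ls ] ∃[ rs ] π ≡ ls ++ a ∷ k ∷ rs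

_≐_ : (ℕ → Set) → (ℕ → Set) → Set
P ≐ Q = ∀ v → (P v → Q v) × (Q v → P v)

-- Inserting n = m + 1 after the entry a (or in front, a = ∅) turns π = L ++ R, where
-- last L = a, into L ++ n ∷ R.  Since n does not occur in π, the position of n in the result
-- recovers L and R, hence a and π; this gives the bijection.
-- As n exceeds every entry, it is a peak exactly when it has a right neighbour k, and every
-- other entry keeps its neighbours except a and k, which become neighbours of n and so are
-- not peaks afterwards.  In a list without repetitions a peak value determines its neighbours,
-- so the adjacent entries a and k cannot both be peaks, which sorts out cases (3)-(5).
module Submission where

open import Defs
open import Data.Nat using (ℕ; suc; _≤_; _<_; s≤s; z≤n; _≡ᵇ_)
open import Data.Nat.Properties using (<-irrefl; <-asym; ≡ᵇ⇒≡; ≡⇒≡ᵇ; ≤-refl; <⇒≢; suc-injective)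
open import Data.Bool using (true; false; T)
open import Data.List using (List; []; _∷_; _++_; [_]; _∷ʳ_; last; initLast; _∷ʳ′_)
open import Data.List.Properties using (∷-injective; ∷ʳ-injectiveʳ; ++-assoc; applyUpTo-∷ʳ; ++-identityʳ)
open import Data.List.Membership.Propositional using (_∈_; _∉_)
open import Data.List.Membership.Propositional.Properties using (∈-∃++; ∈-applyUpTo⁺; ∈-applyUpTo⁻; ∈-++⁺ˡ; ∈-++⁺ʳ)
open import Data.List.Relation.Unary.Any using (here; there)
open import Data.List.Relation.Unary.All as All using (All; []; _∷_)
open import Data.List.Relation.Unary.All.Properties using (++⁻ʳ)
open import Data.List.Relation.Unary.AllPairs using (_∷_)
open import Data.List.Relation.Unary.Unique.Propositional using (Unique)
open import Data.List.Relation.Unary.Unique.Propositional.Properties using (applyUpTo⁺₁)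
open import Data.List.Relation.Binary.Permutation.Propositional using (_↭_; ↭-sym; ↭-trans; ↭-prep; ↭⇒↭ₛ)
open import Data.List.Relation.Binary.Permutation.Propositional.Properties using (∈-resp-↭; drop-mid; ∷↭∷ʳ; shift)
open import Data.List.Relation.Binary.Permutation.Setoid.Properties using (Unique-resp-↭)
open import Data.Maybe using (Maybe; nothing; just)
open import Data.Product using (_×_; ∃-syntax; ∃₂; _,_; proj₁; proj₂)
open import Data.Sum using (_⊎_; inj₁; inj₂; map₁; map₂)
open import Data.Empty using (⊥-elim)
open import Data.Unit using (tt)
open import Function using (_∘′_)
open import Relation.Nullary using (¬_)
open import Relation.Binary.PropositionalEquality using (_≡_; _≢_; refl; sym; trans; cong; subst; setoid)

oneTo-suc↭ : ∀ m → suc m ∷ oneTo m ↭ oneTo (suc m)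
oneTo-suc↭ m = subst (suc m ∷ oneTo m ↭_) (applyUpTo-∷ʳ suc m) (∷↭∷ʳ (suc m) (oneTo m))

IsPerm⇒Unique : ∀ {m π} → IsPerm m π → Unique π
IsPerm⇒Unique {m} p =
  Unique-resp-↭ (setoid ℕ) (↭⇒↭ₛ (↭-sym p)) (applyUpTo⁺₁ suc m (λ i<j _ e → <⇒≢ i<j (suc-injective e)))

IsPerm-∈⁻ : ∀ {m π x} → IsPerm m π → x ∈ π → 1 ≤ x × x ≤ m
IsPerm-∈⁻ p x∈π with ∈-applyUpTo⁻ suc (∈-resp-↭ p x∈π)
... | _ , i<m , refl = s≤s z≤n , i<m

IsPerm-∈⁺ : ∀ {m π x} → IsPerm m π → 1 ≤ x → x ≤ m → x ∈ π
IsPerm-∈⁺ {x = suc i} p _ x≤m = ∈-resp-↭ (↭-sym p) (∈-applyUpTo⁺ suc x≤m)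

IsPerm⇒All< : ∀ {m π} → IsPerm m π → All (_< suc m) π
IsPerm⇒All< p = All.tabulate (λ x∈π → s≤s (proj₂ (IsPerm-∈⁻ p x∈π)))

Unique⇒∉-prefix : ∀ {v : ℕ} L {R} → Unique (L ++ v ∷ R) → v ∉ L
Unique⇒∉-prefix (x ∷ L) (x≢ ∷ _) (here refl) = All.lookup x≢ (∈-++⁺ʳ L (here refl)) refl
Unique⇒∉-prefix (x ∷ L) (_ ∷ u) (there v∈L) = Unique⇒∉-prefix L u v∈L

++-∷-cancel : ∀ {v : ℕ} L {R} L′ {R′} → v ∉ L → v ∉ L′ →
              L ++ v ∷ R ≡ L′ ++ v ∷ R′ → L ≡ L′ × R ≡ R′
++-∷-cancel []      []       _ _ refl = refl , refl
++-∷-cancel []      (x ∷ L′) _ v∉L′ e with refl , _ ← ∷-injective e = ⊥-elim (v∉L′ (here refl))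
++-∷-cancel (x ∷ L) []       v∉L _ e with refl , _ ← ∷-injective e = ⊥-elim (v∉L (here refl))
++-∷-cancel (x ∷ L) (y ∷ L′) v∉L v∉L′ e
  with refl , e′ ← ∷-injective e
  with refl , refl ← ++-∷-cancel L L′ (v∉L ∘′ there) (v∉L′ ∘′ there) e′ = refl , refl

Unique-position : ∀ {v : ℕ} L {R} L′ {R′} → Unique (L ++ v ∷ R) →
                  L ++ v ∷ R ≡ L′ ++ v ∷ R′ → L ≡ L′ × R ≡ R′
Unique-position L L′ u e =
  ++-∷-cancel L L′ (Unique⇒∉-prefix L u) (Unique⇒∉-prefix L′ (subst Unique e u)) e

last-∷ʳ : ∀ {A : Set} (L : List A) a → last (L ∷ʳ a) ≡ just a
last-∷ʳ []          a = refl
last-∷ʳ (x ∷ [])    a = refl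
last-∷ʳ (x ∷ y ∷ L) a = last-∷ʳ (y ∷ L) a

ins-after : ∀ n {a} L R → a ∉ L → ins n (just a) (L ++ a ∷ R) ≡ L ++ a ∷ n ∷ R
ins-after n {a} [] R _ with a ≡ᵇ a in eq
... | true  = refl
... | false = ⊥-elim (subst T eq (≡⇒≡ᵇ a a refl))
ins-after n {a} (x ∷ L) R a∉ with x ≡ᵇ a in eq
... | true  = ⊥-elim (a∉ (here (sym (≡ᵇ⇒≡ x a (subst T (sym eq) tt)))))
... | false = cong (x ∷_) (ins-after n L R (a∉ ∘′ there))

-- last [] = nothing is the insertion position ∅.
ins-after-last : ∀ n L R → Unique (L ++ R) → ins n (last L) (L ++ R) ≡ L ++ n ∷ R
ins-after-last n L R u with initLast L
... | []       = refl
... | L₀ ∷ʳ′ a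
  rewrite last-∷ʳ L₀ a | ++-assoc L₀ [ a ] R | ++-assoc L₀ [ a ] (n ∷ R)
  = ins-after n L₀ R (Unique⇒∉-prefix L₀ u)

IsPerm-suc∉ : ∀ {m π} → IsPerm m π → suc m ∉ π
IsPerm-suc∉ p n∈π = <-irrefl refl (All.lookup (IsPerm⇒All< p) n∈π)

ValidPos-last : ∀ {m} L {R} → IsPerm m (L ++ R) → ValidPos m (last L)
ValidPos-last L p with initLast L
... | []       = tt
... | L₀ ∷ʳ′ a rewrite last-∷ʳ L₀ a = IsPerm-∈⁻ p (∈-++⁺ˡ (∈-++⁺ʳ L₀ (here refl)))

ValidPos-split : ∀ {m a π} → ValidPos m a → IsPerm m π → ∃₂ λ L R → π ≡ L ++ R × last L ≡ a
ValidPos-split {a = nothing} {π} _ _ = [] , π , refl , refl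
ValidPos-split {a = just a} (1≤a , a≤m) p with L₀ , R , refl ← ∈-∃++ (IsPerm-∈⁺ p 1≤a a≤m) =
  L₀ ∷ʳ a , R , sym (++-assoc L₀ [ a ] R) , last-∷ʳ L₀ a

ins-split : ∀ {m a π} → ValidPos m a → IsPerm m π →
            ∃₂ λ L R → π ≡ L ++ R × last L ≡ a × ins (suc m) a π ≡ L ++ suc m ∷ R
ins-split v p with L , R , refl , refl ← ValidPos-split v p =
  L , R , refl , refl , ins-after-last _ L R (IsPerm⇒Unique p)

ins-IsPerm : ∀ m a π → ValidPos m a → IsPerm m π → IsPerm (suc m) (ins (suc m) a π)
ins-IsPerm m a π v p with L , R , refl , _ , e ← ins-split v p rewrite e =
  ↭-trans (shift (suc m) L R) (↭-trans (↭-prep (suc m) p) (oneTo-suc↭ m))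

ins-injective : ∀ m a b π σ → ValidPos m a → ValidPos m b → IsPerm m π → IsPerm m σ →
                ins (suc m) a π ≡ ins (suc m) b σ → a ≡ b × π ≡ σ
ins-injective m a b π σ va vb p q eq
  with L , R , refl , refl , e₁ ← ins-split va p | L′ , R′ , refl , refl , e₂ ← ins-split vb q
  with refl , refl ← ++-∷-cancel L L′ (IsPerm-suc∉ p ∘′ ∈-++⁺ˡ) (IsPerm-suc∉ q ∘′ ∈-++⁺ˡ)
                                    (trans (sym e₁) (trans eq e₂))
  = refl , refl

ins-surjective : ∀ m π′ → IsPerm (suc m) π′ →
                 ∃[ a ] ∃[ π ] ValidPos m a × IsPerm m π × ins (suc m) a π ≡ π′
ins-surjective m π′ p with L , R , refl ← ∈-∃++ (IsPerm-∈⁺ p (s≤s z≤n) ≤-refl) =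
  last L , L ++ R , ValidPos-last L p′ , p′ , ins-after-last (suc m) L R (IsPerm⇒Unique p′)
  where
  p′ : IsPerm m (L ++ R)
  p′ = subst (L ++ R ↭_) (++-identityʳ (oneTo m))
         (drop-mid L (oneTo m) (subst (L ++ suc m ∷ R ↭_) (sym (applyUpTo-∷ʳ suc m)) p))

data Peak : List ℕ → ℕ → Set where
  here  : ∀ {x y z rs} → x < y → z < y → Peak (x ∷ y ∷ z ∷ rs) y
  there : ∀ {w xs y} → Peak xs y → Peak (w ∷ xs) y

PKV⇒Peak : ∀ {π y} → PKV π y → Peak π y
PKV⇒Peak ([]     , _ , _ , _ , refl , x<y , z<y) = here x<y z<y
PKV⇒Peak (_ ∷ ls , rs , x , z , refl , x<y , z<y) = there (PKV⇒Peak (ls , rs , x , z , refl , x<y , z<y))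

Peak⇒PKV : ∀ {π y} → Peak π y → PKV π y
Peak⇒PKV (here x<y z<y) = [] , _ , _ , _ , refl , x<y , z<y
Peak⇒PKV (there {w} p) with ls , rs , x , z , refl , x<y , z<y ← Peak⇒PKV p =
  w ∷ ls , rs , x , z , refl , x<y , z<y

Peak-++ : ∀ {xs v} ys → Peak xs v → Peak (xs ++ ys) v
Peak-++ ys (here x<y z<y) = here x<y z<y
Peak-++ ys (there p)      = there (Peak-++ ys p)

Peak-∷-max⁻ : ∀ {n π v} → All (_< n) π → Peak (n ∷ π) v → Peak π v
Peak-∷-max⁻ (y<n ∷ _) (here n<y _) = ⊥-elim (<-asym n<y y<n)
Peak-∷-max⁻ _         (there p)    = p

Peak-insert-max⁻ : ∀ {n a v} L R → All (_< n) (a ∷ R) → Peak (L ++ a ∷ n ∷ R) v →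
                   (v ≡ n × R ≢ []) ⊎ Peak (L ++ a ∷ R) v
Peak-insert-max⁻ []               R _          (here _ _)   = inj₁ (refl , λ ())
Peak-insert-max⁻ []               R (_ ∷ R<n)  (there p)    = inj₂ (there (Peak-∷-max⁻ R<n p))
Peak-insert-max⁻ (w ∷ [])         R (a<n ∷ _)  (here _ n<a) = ⊥-elim (<-asym n<a a<n)
Peak-insert-max⁻ (w ∷ u ∷ [])     R _          (here p q)   = inj₂ (here p q)
Peak-insert-max⁻ (w ∷ u ∷ t ∷ L)  R _          (here p q)   = inj₂ (here p q)
Peak-insert-max⁻ (w ∷ L)          R bound      (there p)    =
  map₂ there (Peak-insert-max⁻ L R bound p)

Peak-insert⁺ : ∀ {n a k v} L R → Peak (L ++ a ∷ k ∷ R) v →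
               v ≡ a ⊎ v ≡ k ⊎ Peak (L ++ a ∷ n ∷ k ∷ R) v
Peak-insert⁺ []              R (here _ _)  = inj₂ (inj₁ refl)
Peak-insert⁺ []              R (there p)   = inj₂ (inj₂ (there (there p)))
Peak-insert⁺ (w ∷ [])        R (here _ _)  = inj₁ refl
Peak-insert⁺ (w ∷ u ∷ [])    R (here p q)  = inj₂ (inj₂ (here p q))
Peak-insert⁺ (w ∷ u ∷ t ∷ L) R (here p q)  = inj₂ (inj₂ (here p q))
Peak-insert⁺ (w ∷ L)         R (there p)   = map₂ (map₂ there) (Peak-insert⁺ L R p)

Peak-insert-max : ∀ {n a k} L R → a < n → k < n → Peak (L ++ a ∷ n ∷ k ∷ R) n
Peak-insert-max []      R a<n k<n = here a<n k<n
Peak-insert-max (w ∷ L) R a<n k<n = there (Peak-insert-max L R a<n k<n)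

peak-right-neighbour : ∀ L {a} R → Unique (L ++ a ∷ R) → PKV (L ++ a ∷ R) a →
                       ∃₂ λ k rs → R ≡ k ∷ rs × k < a
peak-right-neighbour L R u (ls , rs , x , z , e , _ , z<a)
  with _ , refl ← Unique-position L (ls ∷ʳ x) u (trans e (sym (++-assoc ls [ x ] _))) =
  z , rs , refl , z<a

peak-left-neighbour : ∀ L {a k} R → Unique (L ++ a ∷ k ∷ R) → PKV (L ++ a ∷ k ∷ R) k → a < k
peak-left-neighbour L {a} {k} R u (ls , rs , x , z , e , x<k , _) = subst (_< k) (sym a≡x) x<k
  where
  u′ : Unique ((L ∷ʳ a) ++ k ∷ R)
  u′ = subst Unique (sym (++-assoc L [ a ] (k ∷ R))) u
  e′ : (L ∷ʳ a) ++ k ∷ R ≡ (ls ∷ʳ x) ++ k ∷ z ∷ rs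
  e′ = trans (++-assoc L [ a ] (k ∷ R)) (trans e (sym (++-assoc ls [ x ] (k ∷ z ∷ rs))))
  a≡x : a ≡ x
  a≡x = ∷ʳ-injectiveʳ L ls (proj₁ (Unique-position (L ∷ʳ a) (ls ∷ʳ x) u′ e′))

peak⇒next-not-peak : ∀ L {a k} R → Unique (L ++ a ∷ k ∷ R) →
                 PKV (L ++ a ∷ k ∷ R) a → ¬ PKV (L ++ a ∷ k ∷ R) k
peak⇒next-not-peak L R u pa pk with _ , _ , refl , k<a ← peak-right-neighbour L (_ ∷ R) u pa =
  <-asym k<a (peak-left-neighbour L R u pk)

PKV-∷-max : ∀ {n π} → All (_< n) π → PKV (n ∷ π) ≐ PKV π
PKV-∷-max bound v = (λ q → Peak⇒PKV (Peak-∷-max⁻ bound (PKV⇒Peak q))) ,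
                    (λ q → Peak⇒PKV (there (PKV⇒Peak q)))

PKV-insert-max-end : ∀ {n a} L → a < n → PKV (L ++ a ∷ n ∷ []) ≐ PKV (L ++ a ∷ [])
PKV-insert-max-end {n} {a} L a<n v = to , from
  where
  to : PKV (L ++ a ∷ n ∷ []) v → PKV (L ++ a ∷ []) v
  to q with Peak-insert-max⁻ L [] (a<n ∷ []) (PKV⇒Peak q)
  ... | inj₁ (_ , []≢[]) = ⊥-elim ([]≢[] refl)
  ... | inj₂ r           = Peak⇒PKV r
  from : PKV (L ++ a ∷ []) v → PKV (L ++ a ∷ n ∷ []) v
  from q = Peak⇒PKV (subst (λ l → Peak l v) (++-assoc L [ a ] [ n ]) (Peak-++ [ n ] (PKV⇒Peak q)))

PKV-insert-max : ∀ {n a k} L R → Unique (L ++ a ∷ n ∷ k ∷ R) → All (_< n) (a ∷ k ∷ R) →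
                 PKV (L ++ a ∷ n ∷ k ∷ R) ≐ (λ v → (PKV (L ++ a ∷ k ∷ R) v × v ≢ a × v ≢ k) ⊎ v ≡ n)
PKV-insert-max {n} {a} {k} L R u bound@(a<n ∷ k<n ∷ _) v = to , from
  where
  a-not-peak : ¬ PKV (L ++ a ∷ n ∷ k ∷ R) a
  a-not-peak q with _ , _ , refl , n<a ← peak-right-neighbour L (n ∷ k ∷ R) u q = <-asym n<a a<n
  k-not-peak : ¬ PKV (L ++ a ∷ n ∷ k ∷ R) k
  k-not-peak q =
    <-asym k<n (peak-left-neighbour (L ∷ʳ a) R (subst Unique assoc u) (subst (λ l → PKV l k) assoc q))
    where
    assoc : L ++ a ∷ n ∷ k ∷ R ≡ (L ∷ʳ a) ++ n ∷ k ∷ R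
    assoc = sym (++-assoc L [ a ] (n ∷ k ∷ R))
  to : PKV (L ++ a ∷ n ∷ k ∷ R) v → (PKV (L ++ a ∷ k ∷ R) v × v ≢ a × v ≢ k) ⊎ v ≡ n
  to q with Peak-insert-max⁻ L (k ∷ R) bound (PKV⇒Peak q)
  ... | inj₁ (refl , _) = inj₂ refl
  ... | inj₂ r = inj₁ (Peak⇒PKV r , (λ { refl → a-not-peak q }) , λ { refl → k-not-peak q })
  from : (PKV (L ++ a ∷ k ∷ R) v × v ≢ a × v ≢ k) ⊎ v ≡ n → PKV (L ++ a ∷ n ∷ k ∷ R) v
  from (inj₂ refl) = Peak⇒PKV (Peak-insert-max L R a<n k<n)
  from (inj₁ (q , v≢a , v≢k)) with Peak-insert⁺ {n = n} L R (PKV⇒Peak q)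
  ... | inj₁ refl        = ⊥-elim (v≢a refl)
  ... | inj₂ (inj₁ refl) = ⊥-elim (v≢k refl)
  ... | inj₂ (inj₂ r)    = Peak⇒PKV r

≐-⊎ˡ : ∀ {P S T R : ℕ → Set} → P ≐ (λ v → S v ⊎ R v) → S ≐ T → P ≐ (λ v → T v ⊎ R v)
≐-⊎ˡ P≐S⊎R S≐T v = map₁ (proj₁ (S≐T v)) ∘′ proj₁ (P≐S⊎R v) , proj₂ (P≐S⊎R v) ∘′ map₁ (proj₂ (S≐T v))

PKV-ins-end : ∀ {m} L {a} → IsPerm m (L ++ [ a ]) →
              PKV (ins (suc m) (just a) (L ++ [ a ])) ≐ PKV (L ++ [ a ])
PKV-ins-end {m} L p
  rewrite ins-after (suc m) L [] (Unique⇒∉-prefix L (IsPerm⇒Unique p))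
  = PKV-insert-max-end L (All.head (++⁻ʳ L (IsPerm⇒All< p)))

PKV-ins-inside : ∀ {m} L {a k} R → IsPerm m (L ++ a ∷ k ∷ R) →
                 PKV (ins (suc m) (just a) (L ++ a ∷ k ∷ R))
                 ≐ (λ v → (PKV (L ++ a ∷ k ∷ R) v × v ≢ a × v ≢ k) ⊎ v ≡ suc m)
PKV-ins-inside {m} L {a} {k} R p
  with ins-IsPerm m (just a) _ (IsPerm-∈⁻ p (∈-++⁺ʳ L (here refl))) p
... | p′ rewrite ins-after (suc m) L (k ∷ R) (Unique⇒∉-prefix L (IsPerm⇒Unique p))
  = PKV-insert-max L R (IsPerm⇒Unique p′) (++⁻ʳ L (IsPerm⇒All< p))

PKV-ins-after-peak : ∀ {m π a} → IsPerm m π → 1 ≤ a → a ≤ m → PKV π a →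
                     PKV (ins (suc m) (just a) π) ≐ (λ v → (PKV π v × v ≢ a) ⊎ v ≡ suc m)
PKV-ins-after-peak p 1≤a a≤m pa
  with L , R , refl ← ∈-∃++ (IsPerm-∈⁺ p 1≤a a≤m)
  with _ , _ , refl , _ ← peak-right-neighbour L R (IsPerm⇒Unique p) pa
  = ≐-⊎ˡ (PKV-ins-inside L _ p) λ v →
      (λ (q , v≢a , _) → q , v≢a) ,
      (λ (q , v≢a) → q , v≢a , λ { refl → peak⇒next-not-peak L _ (IsPerm⇒Unique p) pa q })

PKV-ins-before-peak : ∀ {m π a k} → IsPerm m π → Next π a k → PKV π k →
                      PKV (ins (suc m) (just a) π) ≐ (λ v → (PKV π v × v ≢ k) ⊎ v ≡ suc m)
PKV-ins-before-peak p (L , R , refl) pk = ≐-⊎ˡ (PKV-ins-inside L R p) λ v →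
  (λ (q , _ , v≢k) → q , v≢k) ,
  (λ (q , v≢k) → q , (λ { refl → peak⇒next-not-peak L R (IsPerm⇒Unique p) q pk }) , v≢k)

PKV-ins-between-nonpeaks : ∀ {m π a k} → IsPerm m π → Next π a k → ¬ PKV π a → ¬ PKV π k →
                           PKV (ins (suc m) (just a) π) ≐ (λ v → PKV π v ⊎ v ≡ suc m)
PKV-ins-between-nonpeaks p (L , R , refl) ¬pa ¬pk = ≐-⊎ˡ (PKV-ins-inside L R p) λ v →
  proj₁ ,
  (λ q → q , (λ { refl → ¬pa q }) , (λ { refl → ¬pk q }))

lemma4p3 : (m : ℕ) →
    ((a : Maybe ℕ) (π : List ℕ) → ValidPos m a → IsPerm m π → IsPerm (suc m) (ins (suc m) a π))
    × ((a b : Maybe ℕ) (π σ : List ℕ) → ValidPos m a → ValidPos m b → IsPerm m π → IsPerm m σ →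
        ins (suc m) a π ≡ ins (suc m) b σ → (a ≡ b) × (π ≡ σ))
    × ((π′ : List ℕ) → IsPerm (suc m) π′ →
        ∃[ a ] ∃[ π ] ValidPos m a × IsPerm m π × (ins (suc m) a π ≡ π′))
    × ((π : List ℕ) → IsPerm m π →
        (PKV (ins (suc m) nothing π) ≐ PKV π)
        × ((a : ℕ) → IsLast π a → PKV (ins (suc m) (just a) π) ≐ PKV π)
        × ((a : ℕ) → 1 ≤ a → a ≤ m → PKV π a →
            PKV (ins (suc m) (just a) π) ≐ (λ v → (PKV π v × ¬ v ≡ a) ⊎ v ≡ suc m))
        × ((a k : ℕ) → 1 ≤ a → a ≤ m → Next π a k → PKV π k →
            PKV (ins (suc m) (just a) π) ≐ (λ v → (PKV π v × ¬ v ≡ k) ⊎ v ≡ suc m))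
        × ((a k : ℕ) → 1 ≤ a → a ≤ m → Next π a k → ¬ PKV π a → ¬ PKV π k →
            PKV (ins (suc m) (just a) π) ≐ (λ v → PKV π v ⊎ v ≡ suc m)))
lemma4p3 m = ins-IsPerm m , ins-injective m , ins-surjective m , λ π p →
  PKV-∷-max (IsPerm⇒All< p) ,
  (λ { a (L , refl) → PKV-ins-end L p }) ,
  (λ a → PKV-ins-after-peak p) ,
  (λ a k _ _ → PKV-ins-before-peak p) ,
  (λ a k _ _ → PKV-ins-between-nonpeaks p)
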